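{- Let $q$ be a prime power and, for integers $r,s,t,u$, let $\Omega_{r,s,t,u}$ be as in the context. Let $r,s,t,u,\alpha,\beta$ be integers with $t-qs=\widehat t+(q+1)\alpha$, $0\le\widehat t<q+1$, define $\widehat u$ by $u+q^2s-(q+1)\alpha=(q^3+q^2)\beta+\widehat u$, and let $\widehat r=r-s+(q^2+q)\alpha+(q^3+q^2)\beta$. Then $\#\Omega_{r,s,t,u}=\#\Omega_{\widehat r,0,\widehat t,\widehat u}$ and $r+(q-1)s+(q-1)t+u=\widehat r+(q-1)\widehat t+\widehat u$.
   Context: $q$ is a power of a prime. For integers $r,s,t,u$, $\Omega_{r,s,t,u}=\{(i,j,k)\in\mathbb{Z}^3: -r\le i,\ -s\le i+(q^2+q)k<-s+(q^2+q),\ -t\le qi+(q^2+q)j+(q+1)k<-t+(q^2+q),\ -u\le -q^2i-(q^3-q)j-(q^3+q^2-q-1)k\}$. -}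

module Defs where

open import Data.Nat as ℕ using (ℕ)
open import Data.Nat.Primality using (Prime)
open import Data.Integer using (ℤ; +_; _+_; _-_; _*_; -_; _≤_; _<_)
open import Data.Product using (Σ; ∃; _×_; _,_)

IsPrimePower : ℕ → Set
IsPrimePower q = ∃ λ p → ∃ λ e → Prime p × (1 ℕ.≤ e) × q ≡ₙ (p ℕ.^ e)
  where
  open import Relation.Binary.PropositionalEquality using () renaming (_≡_ to _≡ₙ_)

InΩ : ℕ → ℤ → ℤ → ℤ → ℤ → ℤ × ℤ × ℤ → Set
InΩ q r s t u (i , j , k) =
    (- r ≤ i)
  × (- s ≤ i + (Q * Q + Q) * k)
  × (i + (Q * Q + Q) * k < - s + (Q * Q + Q))
  × (- t ≤ Q * i + (Q * Q + Q) * j + (Q + + 1) * k)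
  × (Q * i + (Q * Q + Q) * j + (Q + + 1) * k < - t + (Q * Q + Q))
  × (- u ≤ - (Q * Q) * i - (Q * Q * Q - Q) * j - (Q * Q * Q + Q * Q - Q - + 1) * k)
  where
  Q : ℤ
  Q = + q

Ω : ℕ → ℤ → ℤ → ℤ → ℤ → Set
Ω q r s t u = Σ (ℤ × ℤ × ℤ) (InΩ q r s t u)

-- Ω_{r,s,t,u} is cut out of ℤ³ by bounds on four linear forms ℓ₁,…,ℓ₄, with lower bounds -r, -s, -t, -u.
-- Translating by a vector v therefore maps Ω_{r,s,t,u} bijectively onto
-- Ω_{r - ℓ₁ v, s - ℓ₂ v, t - ℓ₃ v, u - ℓ₄ v}, and r + (q-1)s + (q-1)t + u is unchanged because
-- ℓ₁ + (q-1)ℓ₂ + (q-1)ℓ₃ + ℓ₄ vanishes identically. The vector v = (δᵢ, δⱼ, δₖ) below has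
-- ℓ₂ v = s, ℓ₃ v = qs + (q+1)α and ℓ₄ v = (q³+q²)β - q²s + (q+1)α, so it carries (r, s, t, u) to (r̂, 0, t̂, û).
module Submission where

open import Defs
open import Data.Nat using (ℕ)
open import Data.Integer using (ℤ; +_; _+_; _-_; _*_; -_; _≤_; _<_)
open import Data.Integer.Properties using (≤-irrelevant; <-irrelevant; +-monoˡ-≤; +-monoˡ-<)
open import Data.Integer.Tactic.RingSolver using (solve-∀)
open import Data.Product using (_×_; _,_; proj₁)
open import Data.Product.Function.NonDependent.Propositional using (_×-⇔_)
open import Function.Bundles using (_↔_; _⇔_; mk⇔; mk↔ₛ′; module Equivalence)
open import Relation.Binary.PropositionalEquality
  using (_≡_; refl; sym; trans; cong; cong₂; subst; subst₂; module ≡-Reasoning)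

ℓ₁ ℓ₂ ℓ₃ ℓ₄ : (Q i j k : ℤ) → ℤ
ℓ₁ Q i j k = i
ℓ₂ Q i j k = i + (Q * Q + Q) * k
ℓ₃ Q i j k = Q * i + (Q * Q + Q) * j + (Q + + 1) * k
ℓ₄ Q i j k = - (Q * Q) * i - (Q * Q * Q - Q) * j - (Q * Q * Q + Q * Q - Q - + 1) * k

-- Inlining lets the ring solver see through the forms.
{-# INLINE ℓ₁ #-}
{-# INLINE ℓ₂ #-}
{-# INLINE ℓ₃ #-}
{-# INLINE ℓ₄ #-}

ℓ₂-+ : ∀ (Q i j k a b c : ℤ) → ℓ₂ Q (i + a) (j + b) (k + c) ≡ ℓ₂ Q i j k + ℓ₂ Q a b c
ℓ₂-+ = solve-∀

ℓ₃-+ : ∀ (Q i j k a b c : ℤ) → ℓ₃ Q (i + a) (j + b) (k + c) ≡ ℓ₃ Q i j k + ℓ₃ Q a b c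
ℓ₃-+ = solve-∀

ℓ₄-+ : ∀ (Q i j k a b c : ℤ) → ℓ₄ Q (i + a) (j + b) (k + c) ≡ ℓ₄ Q i j k + ℓ₄ Q a b c
ℓ₄-+ = solve-∀

x+c-c≡x : ∀ (x c : ℤ) → x + c - c ≡ x
x+c-c≡x = solve-∀

x-c+c≡x : ∀ (x c : ℤ) → x - c + c ≡ x
x-c+c≡x = solve-∀

c+x-c≡x : ∀ (c x : ℤ) → c + x - c ≡ x
c+x-c≡x = solve-∀

-r+c≡-[r-c] : ∀ (r c : ℤ) → - r + c ≡ - (r - c)
-r+c≡-[r-c] = solve-∀

-s+n+c≡-[s-c]+n : ∀ (s c n : ℤ) → - s + n + c ≡ - (s - c) + n
-s+n+c≡-[s-c]+n = solve-∀

≤-translate : ∀ c {a b a′ b′ : ℤ} → a + c ≡ a′ → b + c ≡ b′ → a ≤ b ⇔ a′ ≤ b′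
≤-translate c {a} {b} refl refl = mk⇔ (+-monoˡ-≤ c)
  (λ p → subst₂ _≤_ (x+c-c≡x a c) (x+c-c≡x b c) (+-monoˡ-≤ (- c) p))

<-translate : ∀ c {a b a′ b′ : ℤ} → a + c ≡ a′ → b + c ≡ b′ → a < b ⇔ a′ < b′
<-translate c {a} {b} refl refl = mk⇔ (+-monoˡ-< c)
  (λ p → subst₂ _<_ (x+c-c≡x a c) (x+c-c≡x b c) (+-monoˡ-< (- c) p))

InΩ-translate : ∀ q {r s t u} (a b c i j k : ℤ) → let Q = + q in
  InΩ q r s t u (i , j , k) ⇔
  InΩ q (r - ℓ₁ Q a b c) (s - ℓ₂ Q a b c) (t - ℓ₃ Q a b c) (u - ℓ₄ Q a b c) (i + a , j + b , k + c)
InΩ-translate q {r} {s} {t} {u} a b c i j k =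
        ≤-translate (ℓ₁ Q a b c) (-r+c≡-[r-c] r _) refl
  ×-⇔ ≤-translate (ℓ₂ Q a b c) (-r+c≡-[r-c] s _) (sym (ℓ₂-+ Q i j k a b c))
  ×-⇔ <-translate (ℓ₂ Q a b c) (sym (ℓ₂-+ Q i j k a b c)) (-s+n+c≡-[s-c]+n s _ _)
  ×-⇔ ≤-translate (ℓ₃ Q a b c) (-r+c≡-[r-c] t _) (sym (ℓ₃-+ Q i j k a b c))
  ×-⇔ <-translate (ℓ₃ Q a b c) (sym (ℓ₃-+ Q i j k a b c)) (-s+n+c≡-[s-c]+n t _ _)
  ×-⇔ ≤-translate (ℓ₄ Q a b c) (-r+c≡-[r-c] u _) (sym (ℓ₄-+ Q i j k a b c))
  where
  Q = + q

Ω-≡ : ∀ {q r s t u} (x y : Ω q r s t u) → proj₁ x ≡ proj₁ y → x ≡ y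
Ω-≡ (p , a₁ , a₂ , a₃ , a₄ , a₅ , a₆) (.p , b₁ , b₂ , b₃ , b₄ , b₅ , b₆) refl
  rewrite ≤-irrelevant a₁ b₁ | ≤-irrelevant a₂ b₂ | <-irrelevant a₃ b₃
        | ≤-irrelevant a₄ b₄ | <-irrelevant a₅ b₅ | ≤-irrelevant a₆ b₆ = refl

Ω-translate : ∀ q {r s t u r′ s′ t′ u′} (a b c : ℤ) → let Q = + q in
  r′ ≡ r - ℓ₁ Q a b c → s′ ≡ s - ℓ₂ Q a b c → t′ ≡ t - ℓ₃ Q a b c → u′ ≡ u - ℓ₄ Q a b c →
  Ω q r s t u ↔ Ω q r′ s′ t′ u′
Ω-translate q {r} {s} {t} {u} a b c refl refl refl refl = mk↔ₛ′ to from to∘from from∘to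
  where
  Q = + q
  sub-add : ∀ i j k → (i - a + a , j - b + b , k - c + c) ≡ (i , j , k)
  sub-add i j k = cong₂ _,_ (x-c+c≡x i a) (cong₂ _,_ (x-c+c≡x j b) (x-c+c≡x k c))
  add-sub : ∀ i j k → (i + a - a , j + b - b , k + c - c) ≡ (i , j , k)
  add-sub i j k = cong₂ _,_ (x+c-c≡x i a) (cong₂ _,_ (x+c-c≡x j b) (x+c-c≡x k c))
  to : Ω q r s t u → Ω q _ _ _ _
  to ((i , j , k) , p) = (i + a , j + b , k + c) , Equivalence.to (InΩ-translate q a b c i j k) p
  from : Ω q _ _ _ _ → Ω q r s t u
  from ((i , j , k) , p) = (i - a , j - b , k - c) ,
    Equivalence.from (InΩ-translate q a b c (i - a) (j - b) (k - c))
      (subst (InΩ q _ _ _ _) (sym (sub-add i j k)) p)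
  to∘from : ∀ y → to (from y) ≡ y
  to∘from y@((i , j , k) , _) = Ω-≡ {q} (to (from y)) y (sub-add i j k)
  from∘to : ∀ x → from (to x) ≡ x
  from∘to x@((i , j , k) , _) = Ω-≡ {q} (from (to x)) x (add-sub i j k)

weight : (Q r s t u : ℤ) → ℤ
weight Q r s t u = r + (Q - + 1) * s + (Q - + 1) * t + u
{-# INLINE weight #-}

weight-translate : ∀ (Q r s t u a b c : ℤ) →
  weight Q (r - ℓ₁ Q a b c) (s - ℓ₂ Q a b c) (t - ℓ₃ Q a b c) (u - ℓ₄ Q a b c) ≡ weight Q r s t u
weight-translate = solve-∀

weight-translate′ : ∀ (Q r s t u a b c : ℤ) {r′ s′ t′ u′} →
  r′ ≡ r - ℓ₁ Q a b c → s′ ≡ s - ℓ₂ Q a b c → t′ ≡ t - ℓ₃ Q a b c → u′ ≡ u - ℓ₄ Q a b c →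
  weight Q r′ s′ t′ u′ ≡ weight Q r s t u
weight-translate′ Q r s t u a b c refl refl refl refl = weight-translate Q r s t u a b c

weight-zeroˢ : ∀ (Q r t u : ℤ) → weight Q r (+ 0) t u ≡ r + (Q - + 1) * t + u
weight-zeroˢ = solve-∀

δᵢ : (Q s α β : ℤ) → ℤ
δᵢ Q s α β = s - (Q * Q + Q) * α - (Q * Q * Q + Q * Q) * β

δⱼ δₖ : (Q α β : ℤ) → ℤ
δⱼ Q α β = Q * α + (Q * Q - + 1) * β
δₖ Q α β = α + Q * β

{-# INLINE δᵢ #-}
{-# INLINE δⱼ #-}
{-# INLINE δₖ #-}

r-ℓ₁-δ : ∀ (Q r s α β : ℤ) →
  r - ℓ₁ Q (δᵢ Q s α β) (δⱼ Q α β) (δₖ Q α β) ≡ r - s + (Q * Q + Q) * α + (Q * Q * Q + Q * Q) * β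
r-ℓ₁-δ = solve-∀

s-ℓ₂-δ : ∀ (Q s α β : ℤ) → s - ℓ₂ Q (δᵢ Q s α β) (δⱼ Q α β) (δₖ Q α β) ≡ + 0
s-ℓ₂-δ = solve-∀

t-ℓ₃-δ : ∀ (Q s t α β : ℤ) →
  t - ℓ₃ Q (δᵢ Q s α β) (δⱼ Q α β) (δₖ Q α β) ≡ t - Q * s - (Q + + 1) * α
t-ℓ₃-δ = solve-∀

u-ℓ₄-δ : ∀ (Q s u α β : ℤ) →
  u - ℓ₄ Q (δᵢ Q s α β) (δⱼ Q α β) (δₖ Q α β) ≡ u + Q * Q * s - (Q + + 1) * α - (Q * Q * Q + Q * Q) * β
u-ℓ₄-δ = solve-∀

lemma2p7 : (q : ℕ) → IsPrimePower q →
    (r s t u α β t̂ û r̂ : ℤ) →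
    t - + q * s ≡ t̂ + (+ q + + 1) * α →
    + 0 ≤ t̂ → t̂ < + q + + 1 →
    u + + q * + q * s - (+ q + + 1) * α ≡ (+ q * + q * + q + + q * + q) * β + û →
    r̂ ≡ r - s + (+ q * + q + + q) * α + (+ q * + q * + q + + q * + q) * β →
    (Ω q r s t u ↔ Ω q r̂ (+ 0) t̂ û)
    × (r + (+ q - + 1) * s + (+ q - + 1) * t + u ≡ r̂ + (+ q - + 1) * t̂ + û)
lemma2p7 q _ r s t u α β t̂ û r̂ t-division _ _ u-division r̂-def =
  Ω-translate q a b c r̂≡ s≡ t̂≡ û≡ ,
  trans (sym (weight-translate′ Q r s t u a b c r̂≡ s≡ t̂≡ û≡)) (weight-zeroˢ Q r̂ t̂ û)
  where
  open ≡-Reasoning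
  Q = + q
  a = δᵢ Q s α β
  b = δⱼ Q α β
  c = δₖ Q α β
  r̂≡ : r̂ ≡ r - ℓ₁ Q a b c
  r̂≡ = trans r̂-def (sym (r-ℓ₁-δ Q r s α β))
  s≡ : + 0 ≡ s - ℓ₂ Q a b c
  s≡ = sym (s-ℓ₂-δ Q s α β)
  t̂≡ : t̂ ≡ t - ℓ₃ Q a b c
  t̂≡ = begin
    t̂                                 ≡⟨ x+c-c≡x t̂ _ ⟨
    t̂ + (Q + + 1) * α - (Q + + 1) * α ≡⟨ cong (_- (Q + + 1) * α) t-division ⟨
    t - Q * s - (Q + + 1) * α         ≡⟨ t-ℓ₃-δ Q s t α β ⟨
    t - ℓ₃ Q a b c                    ∎
  û≡ : û ≡ u - ℓ₄ Q a b c
  û≡ = begin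
    û                                     ≡⟨ c+x-c≡x (M * β) û ⟨
    M * β + û - M * β                     ≡⟨ cong (_- M * β) u-division ⟨
    u + Q * Q * s - (Q + + 1) * α - M * β ≡⟨ u-ℓ₄-δ Q s u α β ⟨
    u - ℓ₄ Q a b c                        ∎
    where M = Q * Q * Q + Q * Q
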